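{- Let $\ell\in\mathbb N$ and $\alpha_j,\beta_j\in\mathbb N$ for $j=1,\dots,\ell$, and let $\mathbf y(t)=\frac{t}{1-t}$. Then $$\mathbf R^{\alpha_1}\mathbf y^{\beta_1}\cdots\mathbf R^{\alpha_\ell}\mathbf y^{\beta_\ell}(1)=\mathbf R^{\beta_\ell}\mathbf y^{\alpha_\ell}\cdots\mathbf R^{\beta_1}\mathbf y^{\alpha_1}(1).$$
   Context: For a formal power series $f(t)$ in $t,q$ divisible by $t$, $\mathbf R[f](t)=\sum_{k\ge1}f(q^kt)$, and $\mathbf R^n$ is the $n$-fold composite. The expression $\mathbf R^{\alpha_1}\mathbf y^{\beta_1}\cdots\mathbf R^{\alpha_\ell}\mathbf y^{\beta_\ell}(t)$ means $\mathbf R^{\alpha_1}\big[\mathbf y^{\beta_1}\cdot\mathbf R^{\alpha_2}\big[\mathbf y^{\beta_2}\cdots\mathbf R^{\alpha_\ell}[\mathbf y^{\beta_\ell}]\cdots\big]\big](t)$, with $\mathbf y^\beta$ meaning multiplication by $\mathbf y(t)^\beta$; the value at $t=1$ is obtained by substituting $t=1$, understood as a power series in $q$ (convergent in the $q$-adic topology), equivalently as a complex number for $0<|q|<1$. -}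

module Defs where

open import Data.Nat using (ℕ; zero; suc; _+_; _*_; _∸_; _≤ᵇ_)
open import Data.Bool using (if_then_else_; _∧_)
open import Data.List using (List; []; _∷_)
open import Data.Product using (_×_; _,_)

-- Formal power series in t and q with natural-number coefficients:
-- F n m is the coefficient of t^n q^m.
FPS : Set
FPS = ℕ → ℕ → ℕ

sumTo : (ℕ → ℕ) → ℕ → ℕ
sumTo f zero    = f zero
sumTo f (suc n) = sumTo f n + f (suc n)

one : FPS
one zero zero = 1
one _    _    = 0

mul : FPS → FPS → FPS
mul f g n m = sumTo (λ i → sumTo (λ j → f i j * g (n ∸ i) (m ∸ j)) m) n

-- y(t) = t/(1-t) = Σ_{n≥1} t^n
y : FPS
y zero    _       = 0
y (suc n) zero    = 1
y (suc n) (suc m) = 0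

ypow : ℕ → FPS
ypow zero    = one
ypow (suc b) = mul y (ypow b)

-- R[f](t) = Σ_{k≥1} f(q^k t).  The coefficient of t^n q^m of f(q^k t) is
-- f n (m - k n) when k n ≤ m (0 otherwise); for n ≥ 1 only k ≤ m can
-- contribute.  Since R is only applied to series divisible by t, the
-- t^0 coefficient is 0.
R : FPS → FPS
R f zero    m = 0
R f (suc n) m =
  sumTo (λ k → if (1 ≤ᵇ k) ∧ ((k * suc n) ≤ᵇ m)
                 then f (suc n) (m ∸ k * suc n) else 0) m

Rpow : ℕ → FPS → FPS
Rpow zero    f = f
Rpow (suc a) f = R (Rpow a f)

expr : List (ℕ × ℕ) → FPS
expr []            = one
expr ((a , b) ∷ l) = Rpow a (mul (ypow b) (expr l))

-- value at t = 1, as a power series in q: coefficient of q^m is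
-- Σ_n F n m.  For F = R[g] (g divisible by t) the coefficient of
-- t^n q^m vanishes for n > m, so the sum over n ≤ m is the full sum.
evalAt1 : FPS → ℕ → ℕ
evalAt1 F m = sumTo (λ n → F n m) m

-- Instead of t = 1 we evaluate at t = q^s for every s ("ev s"),
-- with evalAt1 = ev 0.  Under this specialisation the two building blocks
-- become purely combinatorial:
--   * R[F] at t = q^s is Σ_{k≥1} F at t = q^(s+k)                (ev-R),
--   * y·G at t = q^s (s ≥ 1) is Σ_{x≥1} q^(s x) · (G at t = q^s) (ev-y).
-- Hence ev s (expr ps) is a nested sum Φ (word ps) s 0, where Φ w s t is a
-- two-parameter family of nested sums indexed by words w in two letters
-- ℛ, 𝒴 (ev-expr).  Φ has the symmetry Φ (dual w) t s = Φ w s t, where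
-- dual reverses the word and exchanges the letters (Φ-dual); it follows
-- from formulas peeling off the LAST letter of a word (Φ-snocℛ, Φ-snoc𝒴).
-- The word of the reversed, swapped list is the dual word, which gives the
-- theorem.  All sums are truncated at a bound M ≥ m; this is harmless since
-- only exponents ≤ m contribute to the coefficient of q^m.
module Submission where

open import Defs
open import Data.Nat using (ℕ; zero; suc; _+_; _*_; _∸_; _≤_; _<_; _≤ᵇ_; z≤n; s≤s; _≤?_)
open import Data.Nat.Properties
open import Data.Nat.Tactic.RingSolver using (solve-∀)
open import Data.Bool using (true; false; if_then_else_; T)
open import Data.Unit using (tt)
open import Data.Empty using (⊥-elim)
open import Data.List using (List; []; _∷_; _++_; [_]; _∷ʳ_; map; reverse; replicate)
open import Data.List.Properties using (map-++; reverse-++; unfold-reverse; map-replicate; ++-assoc; ++-identityʳ)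
open import Data.List.Relation.Unary.All as All using (All; []; _∷_)
open import Data.List.Relation.Unary.All.Properties using (map⁺; ++⁺)
open import Data.Sum using (inj₁; inj₂)
open import Data.Product using (_×_; _,_; proj₁; proj₂; swap)
open import Relation.Binary.PropositionalEquality hiding ([_])
open import Relation.Nullary using (yes; no)

sum1 : ℕ → (ℕ → ℕ) → ℕ
sum1 zero    f = 0
sum1 (suc n) f = sum1 n f + f (suc n)

sumTo-split : ∀ f n → sumTo f n ≡ f 0 + sum1 n f
sumTo-split f zero    = sym (+-identityʳ _)
sumTo-split f (suc n) = trans (cong (_+ f (suc n)) (sumTo-split f n)) (+-assoc (f 0) _ _)

sum1-cong : ∀ n {f g} → (∀ i → 1 ≤ i → i ≤ n → f i ≡ g i) → sum1 n f ≡ sum1 n g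
sum1-cong zero    h = refl
sum1-cong (suc n) h =
  cong₂ _+_ (sum1-cong n (λ i 1≤i i≤n → h i 1≤i (m≤n⇒m≤1+n i≤n))) (h (suc n) (s≤s z≤n) ≤-refl)

sum1-cong′ : ∀ n {f g} → (∀ i → f i ≡ g i) → sum1 n f ≡ sum1 n g
sum1-cong′ n h = sum1-cong n (λ i _ _ → h i)

sumTo-cong : ∀ n {f g} → (∀ i → i ≤ n → f i ≡ g i) → sumTo f n ≡ sumTo g n
sumTo-cong zero    h = h 0 z≤n
sumTo-cong (suc n) h = cong₂ _+_ (sumTo-cong n (λ i i≤n → h i (m≤n⇒m≤1+n i≤n))) (h (suc n) ≤-refl)

sum1-pad : ∀ f a b → a ≤ b → (∀ i → a < i → i ≤ b → f i ≡ 0) → sum1 a f ≡ sum1 b f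
sum1-pad f a zero    z≤n h = refl
sum1-pad f a (suc b) a≤1+b h with m≤n⇒m<n∨m≡n a≤1+b
... | inj₂ refl = refl
... | inj₁ (s≤s a≤b) =
  trans (sum1-pad f a b a≤b (λ i a<i i≤b → h i a<i (m≤n⇒m≤1+n i≤b)))
        (trans (sym (+-identityʳ _)) (cong (sum1 b f +_) (sym (h (suc b) (s≤s a≤b) ≤-refl))))

sum1-zero : ∀ n {f} → (∀ i → 1 ≤ i → i ≤ n → f i ≡ 0) → sum1 n f ≡ 0
sum1-zero n {f} h = sym (sum1-pad f 0 n z≤n h)

sumTo-zero : ∀ n {f} → (∀ i → i ≤ n → f i ≡ 0) → sumTo f n ≡ 0
sumTo-zero n {f} h = trans (sumTo-split f n) (cong₂ _+_ (h 0 z≤n) (sum1-zero n (λ i _ i≤n → h i i≤n)))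

sumTo-pad : ∀ f a b → a ≤ b → (∀ i → a < i → i ≤ b → f i ≡ 0) → sumTo f a ≡ sumTo f b
sumTo-pad f a b a≤b h =
  trans (sumTo-split f a) (trans (cong (f 0 +_) (sum1-pad f a b a≤b h)) (sym (sumTo-split f b)))

sum1-*ʳ : ∀ n f c → sum1 n f * c ≡ sum1 n (λ i → f i * c)
sum1-*ʳ zero    f c = refl
sum1-*ʳ (suc n) f c = trans (*-distribʳ-+ c (sum1 n f) (f (suc n))) (cong (_+ f (suc n) * c) (sum1-*ʳ n f c))

sum1-+ : ∀ n f g → sum1 n (λ i → f i + g i) ≡ sum1 n f + sum1 n g
sum1-+ zero    f g = refl
sum1-+ (suc n) f g = trans (cong (_+ (f (suc n) + g (suc n))) (sum1-+ n f g)) (medial (sum1 n f) (sum1 n g) (f (suc n)) (g (suc n)))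
  where
  medial : ∀ a b c d → (a + b) + (c + d) ≡ (a + c) + (b + d)
  medial = solve-∀

sum1-comm : ∀ A B (f : ℕ → ℕ → ℕ) →
  sum1 A (λ i → sum1 B (λ j → f i j)) ≡ sum1 B (λ j → sum1 A (λ i → f i j))
sum1-comm zero    B f = sym (sum1-zero B (λ _ _ _ → refl))
sum1-comm (suc A) B f =
  trans (cong (_+ sum1 B (f (suc A))) (sum1-comm A B f)) (sym (sum1-+ B _ (f (suc A))))

sum-triangle : ∀ (F : ℕ → ℕ → ℕ) N →
  sumTo (λ n → sum1 n (λ x → F x (n ∸ x))) N ≡ sum1 N (λ x → sumTo (F x) (N ∸ x))
sum-triangle F zero    = refl
sum-triangle F (suc N) = begin
    sumTo (λ n → sum1 n (λ x → F x (n ∸ x))) N + (sum1 N (λ x → F x (suc N ∸ x)) + F (suc N) (N ∸ N))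
  ≡⟨ cong₂ (λ a b → a + (sum1 N (λ x → F x (suc N ∸ x)) + F (suc N) b)) (sum-triangle F N) (n∸n≡0 N) ⟩
    sum1 N (λ x → sumTo (F x) (N ∸ x)) + (sum1 N (λ x → F x (suc N ∸ x)) + F (suc N) 0)
  ≡⟨ sym (+-assoc (sum1 N (λ x → sumTo (F x) (N ∸ x))) _ _) ⟩
    (sum1 N (λ x → sumTo (F x) (N ∸ x)) + sum1 N (λ x → F x (suc N ∸ x))) + F (suc N) 0
  ≡⟨ cong₂ _+_ (sym (sum1-+ N _ _)) (cong (sumTo (F (suc N))) (sym (n∸n≡0 N))) ⟩
    sum1 N (λ x → sumTo (F x) (N ∸ x) + F x (suc N ∸ x)) + sumTo (F (suc N)) (N ∸ N)
  ≡⟨ cong (_+ sumTo (F (suc N)) (N ∸ N)) (sum1-cong N (λ x _ x≤N → sym (extend x x≤N))) ⟩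
    sum1 N (λ x → sumTo (F x) (suc N ∸ x)) + sumTo (F (suc N)) (N ∸ N)
  ∎
  where
  open ≡-Reasoning
  extend : ∀ x → x ≤ N → sumTo (F x) (suc N ∸ x) ≡ sumTo (F x) (N ∸ x) + F x (suc N ∸ x)
  extend x x≤N rewrite +-∸-assoc 1 x≤N = refl

-- q-shifts:  sh c f m  is the coefficient of q^m in q^c · Σ_j f j q^j.

sh : ℕ → (ℕ → ℕ) → ℕ → ℕ
sh c f m = if c ≤ᵇ m then f (m ∸ c) else 0

sh-≤ : ∀ c f m → c ≤ m → sh c f m ≡ f (m ∸ c)
sh-≤ c f m c≤m with c ≤ᵇ m in eq
... | true  = refl
... | false = ⊥-elim (subst T eq (≤⇒≤ᵇ c≤m))

sh-> : ∀ c f m → m < c → sh c f m ≡ 0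
sh-> c f m m<c with c ≤ᵇ m in eq
... | true  = ⊥-elim (<⇒≱ m<c (≤ᵇ⇒≤ c m (subst T (sym eq) tt)))
... | false = refl

sh-of-zero : ∀ c f m → (∀ j → f j ≡ 0) → sh c f m ≡ 0
sh-of-zero c f m h with c ≤ᵇ m
... | true  = h _
... | false = refl

sh-cong : ∀ c {f g} m → (∀ j → j ≤ m → f j ≡ g j) → sh c f m ≡ sh c g m
sh-cong c m h with c ≤ᵇ m
... | true  = h _ (m∸n≤m m c)
... | false = refl

∸<⇒<+ : ∀ {c m k} → c ≤ m → m ∸ c < k → m < c + k
∸<⇒<+ {c} c≤m lt = subst (_< c + _) (m+[n∸m]≡n c≤m) (+-monoʳ-< c lt)

sh-sh : ∀ a b f m → sh a (sh b f) m ≡ sh (a + b) f m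
sh-sh a b f m with a ≤? m
... | no a≰m = trans (sh-> a (sh b f) m a>m) (sym (sh-> (a + b) f m (<-≤-trans a>m (m≤m+n a b))))
  where a>m = ≰⇒> a≰m
... | yes a≤m with b ≤? m ∸ a
...   | yes b≤m∸a = begin
    sh a (sh b f) m      ≡⟨ sh-≤ a (sh b f) m a≤m ⟩
    sh b f (m ∸ a)       ≡⟨ sh-≤ b f (m ∸ a) b≤m∸a ⟩
    f (m ∸ a ∸ b)        ≡⟨ cong f (∸-+-assoc m a b) ⟩
    f (m ∸ (a + b))      ≡⟨ sym (sh-≤ (a + b) f m a+b≤m) ⟩
    sh (a + b) f m       ∎
  where
  open ≡-Reasoning
  a+b≤m : a + b ≤ m
  a+b≤m = subst (a + b ≤_) (m+[n∸m]≡n a≤m) (+-monoʳ-≤ a b≤m∸a)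
...   | no b≰m∸a =
  trans (sh-≤ a (sh b f) m a≤m)
        (trans (sh-> b f (m ∸ a) (≰⇒> b≰m∸a)) (sym (sh-> (a + b) f m (∸<⇒<+ a≤m (≰⇒> b≰m∸a)))))

sh-sum1 : ∀ c B (g : ℕ → ℕ → ℕ) m →
  sh c (λ m' → sum1 B (λ k → g k m')) m ≡ sum1 B (λ k → sh c (g k) m)
sh-sum1 c B g m with c ≤ᵇ m
... | true  = refl
... | false = sym (sum1-zero B (λ _ _ _ → refl))

sh-sumTo : ∀ c B (g : ℕ → ℕ → ℕ) m →
  sh c (λ m' → sumTo (λ k → g k m') B) m ≡ sumTo (λ k → sh c (g k) m) B
sh-sumTo c B g m with c ≤ᵇ m
... | true  = refl
... | false = sym (sumTo-zero B (λ _ _ → refl))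

sh-sum1-sh : ∀ B (a : ℕ → ℕ) (b : ℕ → ℕ → ℕ) (f : ℕ → ℕ → ℕ → ℕ) m →
  sum1 B (λ i → sh (a i) (λ m' → sum1 B (λ j → sh (b i j) (f i j) m')) m)
  ≡ sum1 B (λ i → sum1 B (λ j → sh (a i + b i j) (f i j) m))
sh-sum1-sh B a b f m =
  sum1-cong′ B (λ i → trans (sh-sum1 (a i) B (λ j → sh (b i j) (f i j)) m)
                            (sum1-cong′ B (λ j → sh-sh (a i) (b i j) (f i j) m)))

interchange : ∀ B (a c : ℕ → ℕ) (b d : ℕ → ℕ → ℕ) (f : ℕ → ℕ → ℕ → ℕ) m →
  (∀ i j → a i + b i j ≡ c j + d j i) →
  sum1 B (λ i → sh (a i) (λ m' → sum1 B (λ j → sh (b i j) (f i j) m')) m)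
  ≡ sum1 B (λ j → sh (c j) (λ m' → sum1 B (λ i → sh (d j i) (f i j) m')) m)
interchange B a c b d f m exps =
  trans (sh-sum1-sh B a b f m)
  (trans (sum1-comm B B _)
  (trans (sum1-cong′ B (λ j → sum1-cong′ B (λ i → cong (λ e → sh e (f i j) m) (exps i j))))
         (sym (sh-sum1-sh B c d (λ j i → f i j) m))))

sum1-sh-cong : ∀ B (a : ℕ → ℕ) {F G : ℕ → ℕ → ℕ} m → (∀ i j → j ≤ m → F i j ≡ G i j) →
  sum1 B (λ i → sh (a i) (F i) m) ≡ sum1 B (λ i → sh (a i) (G i) m)
sum1-sh-cong B a m h = sum1-cong′ B (λ i → sh-cong (a i) m (h i))

QFree : FPS → Set
QFree P = ∀ i j → P i (suc j) ≡ 0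

mul-qfree : ∀ P → QFree P → ∀ G n m → mul P G n m ≡ sumTo (λ i → P i 0 * G (n ∸ i) m) n
mul-qfree P hP G n m = sumTo-cong n (λ i _ →
  trans (sumTo-split (λ j → P i j * G (n ∸ i) (m ∸ j)) m)
  (trans (cong (P i 0 * G (n ∸ i) m +_)
                (sum1-zero m (λ { (suc j) _ _ → cong (_* G (n ∸ i) (m ∸ suc j)) (hP i j) })))
         (+-identityʳ _)))

y-qfree : QFree y
y-qfree zero    j = refl
y-qfree (suc i) j = refl

one-qfree : QFree one
one-qfree zero    j = refl
one-qfree (suc i) j = refl

mul-y : ∀ K n m → mul y K n m ≡ sum1 n (λ x → K (n ∸ x) m)
mul-y K n m =
  trans (mul-qfree y y-qfree K n m)
  (trans (sumTo-split _ n) (sum1-cong n (λ { (suc x) _ _ → +-identityʳ _ })))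

mul-one : ∀ G n m → mul one G n m ≡ G n m
mul-one G n m =
  trans (mul-qfree one one-qfree G n m)
  (trans (sumTo-split _ n)
  (trans (cong₂ _+_ (+-identityʳ (G n m)) (sum1-zero n (λ { (suc i) _ _ → refl })))
         (+-identityʳ _)))

ypow-qfree : ∀ b → QFree (ypow b)
ypow-qfree zero    = one-qfree
ypow-qfree (suc b) i j =
  trans (mul-qfree y y-qfree (ypow b) i (suc j))
        (sumTo-zero i (λ i' _ → trans (cong (y i' 0 *_) (ypow-qfree b (i ∸ i') j)) (*-zeroʳ (y i' 0))))

mul-ypow-suc : ∀ b G n m → mul (ypow (suc b)) G n m ≡ mul y (mul (ypow b) G) n m
mul-ypow-suc b G n m = begin
    mul (ypow (suc b)) G n m
  ≡⟨ mul-qfree (ypow (suc b)) (ypow-qfree (suc b)) G n m ⟩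
    sumTo (λ i → ypow (suc b) i 0 * G (n ∸ i) m) n
  ≡⟨ sumTo-cong n (λ i _ → trans (cong (_* G (n ∸ i) m) (mul-y (ypow b) i 0))
                                 (sum1-*ʳ i (λ x → ypow b (i ∸ x) 0) (G (n ∸ i) m))) ⟩
    sumTo (λ i → sum1 i (λ x → ypow b (i ∸ x) 0 * G (n ∸ i) m)) n
  ≡⟨ sumTo-cong n (λ i _ → sum1-cong i (λ x _ x≤i →
       cong (λ v → ypow b (i ∸ x) 0 * G (n ∸ v) m) (sym (m+[n∸m]≡n x≤i)))) ⟩
    sumTo (λ i → sum1 i (λ x → F x (i ∸ x))) n
  ≡⟨ sum-triangle F n ⟩
    sum1 n (λ x → sumTo (F x) (n ∸ x))
  ≡⟨ sum1-cong′ n (λ x → sym (trans (mul-qfree (ypow b) (ypow-qfree b) G (n ∸ x) m)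
       (sumTo-cong (n ∸ x) (λ i' _ → cong (λ v → ypow b i' 0 * G v m) (∸-+-assoc n x i'))))) ⟩
    sum1 n (λ x → mul (ypow b) G (n ∸ x) m)
  ≡⟨ sym (mul-y (mul (ypow b) G) n m) ⟩
    mul y (mul (ypow b) G) n m
  ∎
  where
  open ≡-Reasoning
  F : ℕ → ℕ → ℕ
  F x i' = ypow b i' 0 * G (n ∸ (x + i')) m

-- Specialisation t = q^s:  ev s F m  is the coefficient of q^m in F(q^s).
-- For s = 0 this is definitionally evalAt1.

ev : ℕ → FPS → ℕ → ℕ
ev s F m = sumTo (λ n → sh (s * n) (F n) m) m

ev-cong : ∀ s {F G : FPS} m → (∀ n j → F n j ≡ G n j) → ev s F m ≡ ev s G m
ev-cong s m h = sumTo-cong m (λ n _ → sh-cong (s * n) m (λ j _ → h n j))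

ev-one : ∀ s m → ev s one m ≡ one 0 m
ev-one s m =
  trans (sumTo-split (λ n → sh (s * n) (one n) m) m)
  (trans (cong₂ _+_ constant (sum1-zero m (λ { (suc n) _ _ → sh-of-zero (s * suc n) (one (suc n)) m (λ _ → refl) })))
         (+-identityʳ _))
  where
  constant : sh (s * 0) (one 0) m ≡ one 0 m
  constant rewrite *-zeroʳ s = refl

NoConst : FPS → Set
NoConst F = ∀ j → F 0 j ≡ 0

R-coeff : ∀ F n M m → m ≤ M → R F (suc n) m ≡ sum1 M (λ k → sh (k * suc n) (F (suc n)) m)
R-coeff F n M m m≤M =
  trans (sumTo-split _ m)
  (trans (sum1-cong m (λ { (suc k) _ _ → refl }))
         (sum1-pad _ m M m≤M (λ k m<k _ → sh-> (k * suc n) (F (suc n)) m (<-≤-trans m<k (m≤m*n k (suc n))))))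

ev-R : ∀ M F → NoConst F → ∀ s m → m ≤ M → ev s (R F) m ≡ sum1 M (λ k → ev (s + k) F m)
ev-R M F F0 s m m≤M = begin
    ev s (R F) m
  ≡⟨ sumTo-split _ m ⟩
    sh (s * 0) (R F 0) m + sum1 m (λ n → sh (s * n) (R F n) m)
  ≡⟨ cong₂ _+_ (sh-of-zero (s * 0) (R F 0) m (λ _ → refl)) (sum1-cong m (λ { (suc n) _ _ → term n })) ⟩
    sum1 m (λ n → sum1 M (λ k → sh (s * n + k * n) (F n) m))
  ≡⟨ sum1-comm m M _ ⟩
    sum1 M (λ k → sum1 m (λ n → sh (s * n + k * n) (F n) m))
  ≡⟨ sum1-cong′ M (λ k → sym (trans (sumTo-split _ m)
       (cong₂ _+_ (sh-of-zero ((s + k) * 0) (F 0) m F0)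
                  (sum1-cong′ m (λ n → cong (λ c → sh c (F n) m) (*-distribʳ-+ n s k)))))) ⟩
    sum1 M (λ k → ev (s + k) F m)
  ∎
  where
  open ≡-Reasoning
  term : ∀ n → sh (s * suc n) (R F (suc n)) m ≡ sum1 M (λ k → sh (s * suc n + k * suc n) (F (suc n)) m)
  term n =
    trans (sh-cong (s * suc n) m (λ j j≤m → R-coeff F n M j (≤-trans j≤m m≤M)))
    (trans (sh-sum1 (s * suc n) M (λ k → sh (k * suc n) (F (suc n))) m)
           (sum1-cong′ M (λ k → sh-sh (s * suc n) (k * suc n) (F (suc n)) m)))

ev-pad : ∀ s' H m N → m ≤ N → ev (suc s') H m ≡ sumTo (λ n → sh (suc s' * n) (H n) m) N
ev-pad s' H m N m≤N =
  sumTo-pad _ m N m≤N (λ n m<n _ → sh-> (suc s' * n) (H n) m (<-≤-trans m<n (m≤n*m n (suc s'))))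

sh-ev : ∀ s' x H m →
  sh (suc s' * x) (ev (suc s') H) m ≡ sumTo (λ n → sh (suc s' * (x + n)) (H n) m) m
sh-ev s' x H m =
  trans (sh-cong (s * x) m (λ m' m'≤m → ev-pad s' H m' m m'≤m))
  (trans (sh-sumTo (s * x) m (λ n → sh (s * n) (H n)) m)
         (sumTo-cong m (λ n _ → trans (sh-sh (s * x) (s * n) (H n) m)
                                       (cong (λ c → sh c (H n) m) (sym (*-distribˡ-+ s x n))))))
  where s = suc s'

ev-y : ∀ M H s' m → m ≤ M → ev (suc s') (mul y H) m ≡ sum1 M (λ x → sh (suc s' * x) (ev (suc s') H) m)
ev-y M H s' m m≤M = begin
    ev s (mul y H) m
  ≡⟨ sumTo-cong m (λ n _ → trans (sh-cong (s * n) m (λ j _ → mul-y H n j)) (sh-sum1 (s * n) n (λ x j → H (n ∸ x) j) m)) ⟩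
    sumTo (λ n → sum1 n (λ x → sh (s * n) (H (n ∸ x)) m)) m
  ≡⟨ sumTo-cong m (λ n _ → sum1-cong n (λ x _ x≤n → cong (λ v → sh (s * v) (H (n ∸ x)) m) (sym (m+[n∸m]≡n x≤n)))) ⟩
    sumTo (λ n → sum1 n (λ x → G x (n ∸ x))) m
  ≡⟨ sum-triangle G m ⟩
    sum1 m (λ x → sumTo (G x) (m ∸ x))
  ≡⟨ sum1-cong′ m (λ x → sumTo-pad (G x) (m ∸ x) m (m∸n≤m m x) (λ n lt _ → sh-> (s * (x + n)) (H n) m (beyond x n lt))) ⟩
    sum1 m (λ x → sumTo (G x) m)
  ≡⟨ sum1-cong m (λ x _ _ → sym (sh-ev s' x H m)) ⟩
    sum1 m (λ x → sh (s * x) (ev s H) m)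
  ≡⟨ sum1-pad _ m M m≤M (λ x m<x _ → sh-> (s * x) (ev s H) m (<-≤-trans m<x (m≤n*m x s))) ⟩
    sum1 M (λ x → sh (s * x) (ev s H) m)
  ∎
  where
  open ≡-Reasoning
  s = suc s'
  G : ℕ → ℕ → ℕ
  G x n = sh (s * (x + n)) (H n) m
  beyond : ∀ x n → m ∸ x < n → m < s * (x + n)
  beyond x n lt with x ≤? m
  ... | yes x≤m = <-≤-trans (∸<⇒<+ x≤m lt) (m≤n*m (x + n) s)
  ... | no x≰m  = <-≤-trans (≰⇒> x≰m) (≤-trans (m≤m+n x n) (m≤n*m (x + n) s))

data Letter : Set where
  ℛ 𝒴 : Letter

swapLetter : Letter → Letter
swapLetter ℛ = 𝒴
swapLetter 𝒴 = ℛ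

dual : List Letter → List Letter
dual w = map swapLetter (reverse w)

Φ : ℕ → List Letter → ℕ → ℕ → ℕ → ℕ
Φ M []      s t m = one 0 m
Φ M (ℛ ∷ w) s t m = sum1 M (λ k → sh (t * k) (Φ M w (s + k) t) m)
Φ M (𝒴 ∷ w) s t m = sum1 M (λ x → sh (s * x) (Φ M w s t) m)

ℛ𝒴-exponents : ∀ s t k x → t * k + (s + k) * x ≡ s * x + (t + x) * k
ℛ𝒴-exponents = solve-∀

module _ (M : ℕ) where

  Φ-snocℛ : ∀ w s t m → Φ M (w ++ [ ℛ ]) s t m ≡ sum1 M (λ k → sh (t * k) (Φ M w s t) m)
  Φ-snocℛ []      s t m = refl
  Φ-snocℛ (ℛ ∷ w) s t m =
    trans (sum1-sh-cong M (t *_) m (λ k j _ → Φ-snocℛ w (s + k) t j))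
          (interchange M (t *_) (t *_) (λ _ j → t * j) (λ _ k → t * k) (λ k _ → Φ M w (s + k) t) m
                       (λ k j → +-comm (t * k) (t * j)))
  Φ-snocℛ (𝒴 ∷ w) s t m =
    trans (sum1-sh-cong M (s *_) m (λ x j _ → Φ-snocℛ w s t j))
          (interchange M (s *_) (t *_) (λ _ k → t * k) (λ _ x → s * x) (λ _ _ → Φ M w s t) m
                       (λ x k → +-comm (s * x) (t * k)))

  Φ-snoc𝒴 : ∀ w s t m → Φ M (w ++ [ 𝒴 ]) s t m ≡ sum1 M (λ x → sh (s * x) (Φ M w s (t + x)) m)
  Φ-snoc𝒴 []      s t m = refl
  Φ-snoc𝒴 (ℛ ∷ w) s t m =
    trans (sum1-sh-cong M (t *_) m (λ k j _ → Φ-snoc𝒴 w (s + k) t j))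
          (interchange M (t *_) (s *_) (λ k x → (s + k) * x) (λ x k → (t + x) * k)
                       (λ k x → Φ M w (s + k) (t + x)) m (ℛ𝒴-exponents s t))
  Φ-snoc𝒴 (𝒴 ∷ w) s t m =
    trans (sum1-sh-cong M (s *_) m (λ x j _ → Φ-snoc𝒴 w s t j))
          (interchange M (s *_) (s *_) (λ _ z → s * z) (λ _ x → s * x) (λ _ z → Φ M w s (t + z)) m
                       (λ x z → +-comm (s * x) (s * z)))

  dual-cons : ∀ c w → dual (c ∷ w) ≡ dual w ++ [ swapLetter c ]
  dual-cons c w = trans (cong (map swapLetter) (unfold-reverse c w)) (map-++ swapLetter (reverse w) [ c ])

  Φ-dual : ∀ w s t m → Φ M (dual w) t s m ≡ Φ M w s t m
  Φ-dual []      s t m = refl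
  Φ-dual (ℛ ∷ w) s t m rewrite dual-cons ℛ w =
    trans (Φ-snoc𝒴 (dual w) t s m) (sum1-sh-cong M (t *_) m (λ k j _ → Φ-dual w (s + k) t j))
  Φ-dual (𝒴 ∷ w) s t m rewrite dual-cons 𝒴 w =
    trans (Φ-snocℛ (dual w) t s m) (sum1-sh-cong M (s *_) m (λ x j _ → Φ-dual w s t j))

word : List (ℕ × ℕ) → List Letter
word []            = []
word ((a , b) ∷ l) = replicate a ℛ ++ (replicate b 𝒴 ++ word l)

Positive : ℕ × ℕ → Set
Positive p = 1 ≤ proj₁ p × 1 ≤ proj₂ p

mul-ypow-noConst : ∀ b G → NoConst (mul (ypow (suc b)) G)
mul-ypow-noConst b G j = sumTo-zero j (λ j' _ → cong (_* G 0 (j ∸ j')) (sumTo-zero j' (λ _ _ → refl)))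

Rpow-noConst : ∀ a F → NoConst F → NoConst (Rpow a F)
Rpow-noConst zero    F h   = h
Rpow-noConst (suc a) F h j = refl

module _ (M : ℕ) where

  Represents : FPS → List Letter → Set
  Represents F w = ∀ s → 1 ≤ s → ∀ m → m ≤ M → ev s F m ≡ Φ M w s 0 m

  -- Each R prepends an ℛ; after at least one R also s = 0 is allowed.
  ev-Rpow : ∀ a F w → NoConst F → Represents F w →
            ∀ s → 1 ≤ a + s → ∀ m → m ≤ M → ev s (Rpow a F) m ≡ Φ M (replicate a ℛ ++ w) s 0 m
  ev-Rpow zero    F w F0 rep s 1≤s m m≤M = rep s 1≤s m m≤M
  ev-Rpow (suc a) F w F0 rep s _   m m≤M =
    trans (ev-R M (Rpow a F) (Rpow-noConst a F F0) s m m≤M)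
          (sum1-cong M (λ k 1≤k _ → ev-Rpow a F w F0 rep (s + k) (positive k 1≤k) m m≤M))
    where
    positive : ∀ k → 1 ≤ k → 1 ≤ a + (s + k)
    positive k 1≤k = ≤-trans 1≤k (≤-trans (m≤n+m k s) (m≤n+m (s + k) a))

  ev-ypow : ∀ b G w → Represents G w → Represents (mul (ypow b) G) (replicate b 𝒴 ++ w)
  ev-ypow zero    G w rep s 1≤s m m≤M = trans (ev-cong s m (mul-one G)) (rep s 1≤s m m≤M)
  ev-ypow (suc b) G w rep (suc s') _ m m≤M =
    trans (ev-cong (suc s') m (mul-ypow-suc b G))
    (trans (ev-y M (mul (ypow b) G) s' m m≤M)
           (sum1-sh-cong M (suc s' *_) m (λ x j j≤m → ev-ypow b G w rep (suc s') (s≤s z≤n) j (≤-trans j≤m m≤M))))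

  ev-expr : ∀ ps → All Positive ps → ∀ s m → m ≤ M → ev s (expr ps) m ≡ Φ M (word ps) s 0 m
  ev-expr []                    []                             s m m≤M = ev-one s m
  ev-expr ((suc a , suc b) ∷ l) ((s≤s z≤n , s≤s z≤n) ∷ positive) s m m≤M =
    ev-Rpow (suc a) (mul (ypow (suc b)) (expr l)) (replicate (suc b) 𝒴 ++ word l)
            (mul-ypow-noConst b (expr l))
            (ev-ypow (suc b) (expr l) (word l) (λ s' _ → ev-expr l positive s'))
            s (s≤s z≤n) m m≤M

word-++ : ∀ ps qs → word (ps ++ qs) ≡ word ps ++ word qs
word-++ []             qs = refl
word-++ ((a , b) ∷ ps) qs =
  trans (cong (λ z → replicate a ℛ ++ (replicate b 𝒴 ++ z)) (word-++ ps qs))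
  (trans (cong (replicate a ℛ ++_) (sym (++-assoc (replicate b 𝒴) (word ps) (word qs))))
         (sym (++-assoc (replicate a ℛ) (replicate b 𝒴 ++ word ps) (word qs))))

dual-++ : ∀ xs ys → dual (xs ++ ys) ≡ dual ys ++ dual xs
dual-++ xs ys = trans (cong (map swapLetter) (reverse-++ xs ys)) (map-++ swapLetter (reverse ys) (reverse xs))

reverse-replicate : ∀ {A : Set} n (x : A) → reverse (replicate n x) ≡ replicate n x
reverse-replicate zero    x = refl
reverse-replicate (suc n) x =
  trans (unfold-reverse x (replicate n x)) (trans (cong (_∷ʳ x) (reverse-replicate n x)) (snoc n))
  where
  snoc : ∀ n → replicate n x ∷ʳ x ≡ x ∷ replicate n x
  snoc zero    = refl
  snoc (suc n) = cong (x ∷_) (snoc n)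

dual-replicate : ∀ n c → dual (replicate n c) ≡ replicate n (swapLetter c)
dual-replicate n c = trans (cong (map swapLetter) (reverse-replicate n c)) (map-replicate swapLetter n c)

word-dual : ∀ ps → word (map swap (reverse ps)) ≡ dual (word ps)
word-dual []             = refl
word-dual ((a , b) ∷ ps) = begin
    word (map swap (reverse ((a , b) ∷ ps)))
  ≡⟨ cong (λ z → word (map swap z)) (unfold-reverse (a , b) ps) ⟩
    word (map swap (reverse ps ++ [ (a , b) ]))
  ≡⟨ cong word (map-++ swap (reverse ps) [ (a , b) ]) ⟩
    word (map swap (reverse ps) ++ [ (b , a) ])
  ≡⟨ word-++ (map swap (reverse ps)) [ (b , a) ] ⟩
    word (map swap (reverse ps)) ++ (replicate b ℛ ++ (replicate a 𝒴 ++ []))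
  ≡⟨ cong₂ (λ u v → u ++ (replicate b ℛ ++ v)) (word-dual ps) (++-identityʳ (replicate a 𝒴)) ⟩
    dual (word ps) ++ (replicate b ℛ ++ replicate a 𝒴)
  ≡⟨ sym (++-assoc (dual (word ps)) (replicate b ℛ) (replicate a 𝒴)) ⟩
    (dual (word ps) ++ replicate b ℛ) ++ replicate a 𝒴
  ≡⟨ sym (cong₂ (λ u v → (dual (word ps) ++ u) ++ v) (dual-replicate b 𝒴) (dual-replicate a ℛ)) ⟩
    (dual (word ps) ++ dual (replicate b 𝒴)) ++ dual (replicate a ℛ)
  ≡⟨ sym (cong (_++ dual (replicate a ℛ)) (dual-++ (replicate b 𝒴) (word ps))) ⟩
    dual (replicate b 𝒴 ++ word ps) ++ dual (replicate a ℛ)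
  ≡⟨ sym (dual-++ (replicate a ℛ) (replicate b 𝒴 ++ word ps)) ⟩
    dual (word ((a , b) ∷ ps))
  ∎
  where open ≡-Reasoning

All-reverse : ∀ {P : ℕ × ℕ → Set} {xs} → All P xs → All P (reverse xs)
All-reverse []                         = []
All-reverse {P} {x ∷ xs} (px ∷ pxs) =
  subst (All P) (sym (unfold-reverse x xs)) (++⁺ (All-reverse pxs) (px ∷ []))

positive-dual : ∀ ps → All Positive ps → All Positive (map swap (reverse ps))
positive-dual ps pos = map⁺ (All.map (λ { (u , v) → v , u }) (All-reverse pos))

corollary3p4 : (ps : List (ℕ × ℕ)) → ps ≢ [] →
    All (λ p → 1 ≤ proj₁ p × 1 ≤ proj₂ p) ps →
    (m : ℕ) → evalAt1 (expr ps) m ≡ evalAt1 (expr (map swap (reverse ps))) m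
corollary3p4 ps _ pos m = begin
    evalAt1 (expr ps) m
  ≡⟨ ev-expr m ps pos 0 m ≤-refl ⟩
    Φ m (word ps) 0 0 m
  ≡⟨ sym (Φ-dual m (word ps) 0 0 m) ⟩
    Φ m (dual (word ps)) 0 0 m
  ≡⟨ cong (λ w → Φ m w 0 0 m) (sym (word-dual ps)) ⟩
    Φ m (word (map swap (reverse ps))) 0 0 m
  ≡⟨ sym (ev-expr m (map swap (reverse ps)) (positive-dual ps pos) 0 m ≤-refl) ⟩
    evalAt1 (expr (map swap (reverse ps))) m
  ∎
  where open ≡-Reasoning
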